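{- Let $n\geq 14$ and let $C$ be a locating-dominating code in $C_n(1,3)$. For every $c\in C$, either $s(c)\leq 17/6$ or $s(c)\in\{3, 37/12, 10/3\}$. Moreover: $s(c)=3$ if and only if $c$ belongs to a pattern $S1$ or $S3$; $s(c)=37/12$ if and only if $c$ belongs to a pattern $S4$; and $s(c)=10/3$ if and only if $c$ belongs to a pattern $S6$.
   Context: For a positive integer $n$, the circulant graph $C_n(1,3)$ has vertex set $\mathbb{Z}_n$, and $u$ is adjacent to $u\pm1$ and $u\pm 3$ (modulo $n$); $N[u]=\{u,u\pm1,u\pm3\}$. For a code (nonempty subset) $C\subseteq\mathbb{Z}_n$, $I(u)=I(C;u)=N[u]\cap C$. $C$ is locating-dominating if $I(C;u)\neq\emptyset$ for all vertices $u$ and $I(C;u)\neq I(C;v)$ for all distinct $u,v\in\mathbb{Z}_n\setminus C$. The share of a codeword $c\in C$ is $s(c)=\sum_{u\in N[c]} 1/|I(C;u)|$. Patterns: a pattern is a word $w_{ -a}\dots w_{ -1}w_0w_1\dots w_b$ over the symbols $x$ (codeword), $o$ (non-codeword), $*$ (either), with the position $0$ distinguished. A codeword $c$ belongs to the pattern if either for all $i\in\{ -a,\dots,b\}$ the vertex $c+i$ satisfies $w_i$ (i.e. $c+i\in C$ if $w_i=x$, $c+i\notin C$ if $w_i=o$, no condition if $w_i=*$), or the same holds with $c-i$ in place of $c+i$ for all $i$ (the symmetric version). The patterns, indexed from $-7$ (resp. $-6$) to $6$, with position $0$ written in brackets, are: $S1$: $x\,x\,x\,o\,o\,o\,x\,[x]\,o\,o\,o\,o\,*\,x$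 (positions $-7,\dots,6$); $S3$: $x\,x\,o\,o\,o\,o\,x\,[x]\,o\,o\,o\,o\,x\,x$ (positions $-7,\dots,6$); $S4$: $o\,x\,o\,o\,o\,o\,[x]\,o\,x\,o\,x\,*\,x$ (positions $-6,\dots,6$); $S6$: $x\,x\,x\,o\,o\,o\,o\,[x]\,o\,o\,o\,x\,x\,x$ (positions $-7,\dots,6$). -}

module Defs where

open import Data.Nat as ℕ using (ℕ; zero; suc; NonZero)
open import Data.Nat.DivMod using (_mod_)
open import Data.Integer as ℤ using (ℤ; +_; -[1+_])
open import Data.Integer.DivMod using (_%ℕ_)
open import Data.Fin using (Fin; toℕ; _≟_)
open import Data.Fin.Subset using (Subset; ∣_∣)
open import Data.Vec using (tabulate)
open import Data.Bool using (Bool; true; false; _∧_; _∨_; if_then_else_)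
open import Data.List using (List; []; _∷_; foldr; map)
open import Data.Bool.ListAction using (any)
open import Data.List.Base using (allFin)
open import Data.Rational as ℚ using (ℚ; 0ℚ)
open import Data.Product using (_×_; ∃)
open import Data.Unit using (⊤)
open import Data.Sum using (_⊎_)
open import Relation.Binary.PropositionalEquality using (_≡_; _≢_)
open import Relation.Nullary using (¬_)
open import Relation.Nullary.Decidable using (⌊_⌋)

infixl 6 _⊕_
-- Vertices of C_n(1,3) are Fin n (= ℤ_n).  u ⊕ i is u + i (mod n), i ∈ ℤ.
_⊕_ : {n : ℕ} .{{_ : NonZero n}} → Fin n → ℤ → Fin n
_⊕_ {n} u i = ((+ toℕ u ℤ.+ i) %ℕ n) mod n

Code : ℕ → Set
Code n = Fin n → Bool

nbrList : {n : ℕ} .{{_ : NonZero n}} → Fin n → List (Fin n)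
nbrList u = u ∷ (u ⊕ + 1) ∷ (u ⊕ ℤ.- + 1) ∷ (u ⊕ + 3) ∷ (u ⊕ ℤ.- + 3) ∷ []

N[_] : {n : ℕ} .{{_ : NonZero n}} → Fin n → Subset n
N[ u ] = tabulate (λ v → any (λ w → ⌊ v ≟ w ⌋) (nbrList u))

I : {n : ℕ} .{{_ : NonZero n}} → Code n → Fin n → Subset n
I C u = tabulate (λ v → any (λ w → ⌊ v ≟ w ⌋) (nbrList u) ∧ C v)

IsLocatingDominating : {n : ℕ} .{{_ : NonZero n}} → Code n → Set
IsLocatingDominating {n} C =
  ∃ (λ (c : Fin n) → C c ≡ true)
  × ((u : Fin n) → I C u ≢ Data.Fin.Subset.⊥)
  × ((u v : Fin n) → C u ≡ false → C v ≡ false → u ≢ v → I C u ≢ I C v)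

-- 1/k in ℚ (with the harmless convention 1/0 = 0; never used for LD codes)
recip : ℕ → ℚ
recip zero = 0ℚ
recip (suc k) = + 1 ℚ./ suc k

share : {n : ℕ} .{{_ : NonZero n}} → Code n → Fin n → ℚ
share {n} C c =
  foldr ℚ._+_ 0ℚ
    (map (λ u → if Data.Vec.lookup N[ c ] u then recip ∣ I C u ∣ else 0ℚ) (allFin n))

data Sym : Set where
  x o ✱ : Sym

satisfies : Bool → Sym → Set
satisfies b x = b ≡ true
satisfies b o = b ≡ false
satisfies b ✱ = ⊤

-- A pattern: offset of its first symbol, and the word.
record Pattern : Set where
  constructor pat
  field
    start : ℤ
    word  : List Sym

matchFrom : {n : ℕ} .{{_ : NonZero n}} → Code n → Fin n → (ℤ → ℤ) → ℤ → List Sym → Set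
matchFrom C c σ i [] = ⊤
matchFrom C c σ i (w ∷ ws) = satisfies (C (c ⊕ σ i)) w × matchFrom C c σ (ℤ.suc i) ws

-- c belongs to pattern p (either orientation)
BelongsTo : {n : ℕ} .{{_ : NonZero n}} → Code n → Fin n → Pattern → Set
BelongsTo C c (pat s w) = matchFrom C c (λ i → i) s w ⊎ matchFrom C c ℤ.-_ s w

S1 S3 S4 S6 : Pattern
S1 = pat (ℤ.- + 7) (x ∷ x ∷ x ∷ o ∷ o ∷ o ∷ x ∷ x ∷ o ∷ o ∷ o ∷ o ∷ ✱ ∷ x ∷ [])
S3 = pat (ℤ.- + 7) (x ∷ x ∷ o ∷ o ∷ o ∷ o ∷ x ∷ x ∷ o ∷ o ∷ o ∷ o ∷ x ∷ x ∷ [])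
S4 = pat (ℤ.- + 6) (o ∷ x ∷ o ∷ o ∷ o ∷ o ∷ x ∷ o ∷ x ∷ o ∷ x ∷ ✱ ∷ x ∷ [])
S6 = pat (ℤ.- + 7) (x ∷ x ∷ x ∷ o ∷ o ∷ o ∷ o ∷ x ∷ o ∷ o ∷ o ∷ x ∷ x ∷ x ∷ [])

module Submission where

-- Everything in the statement only looks at the vertices c + i with -7 ≤ i ≤ 7: the share
-- at the vertices within distance 3 of N[c], the patterns at offsets up to 7.  Once n ≥ 7
-- the five vertices of each N[u] are distinct, so the sum over ℤ_n defining the share
-- collapses to a sum over offsets in ℤ, and the theorem becomes a statement about the
-- labelling i ↦ [c + i ∈ C] of [-7, 7].  For labellings in which 0 is a codeword and a few
-- of the domination and separation conditions of a locating-dominating code hold, the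
-- classification is checked exhaustively over all 2¹⁵ labellings.

open import Defs
open import Algebra.Bundles using (CommutativeMonoid)
open import Data.Bool as Bool using (Bool; true; false; _∧_; _∨_; not; if_then_else_; T)
open import Data.Bool.ListAction using (any; all)
open import Data.Bool.Properties using (¬-not; T-≡; T-∧; ⇔→≡)
open import Data.Fin using (Fin; _≟_; toℕ)
open import Data.Fin.Properties using (suc-injective; toℕ-injective; toℕ-fromℕ<; toℕ<n)
import Data.Fin.Subset as Subset
open import Data.Fin.Subset.Properties using (Empty-unique)
open import Data.Integer as ℤ using (ℤ; +_; -[1+_]; 0ℤ; ∣_∣; _%ℕ_; _/ℕ_)
import Data.Integer.Properties as ℤₚ
open import Data.Integer.DivMod using (a≡a%ℕn+[a/ℕn]*n; n%ℕd<d)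
open import Data.Integer.Tactic.RingSolver using (solve-∀)
open import Data.List as List using (List; []; _∷_; foldr; map)
open import Data.List.Properties using (map-tabulate; map-∘; map-cong)
import Data.List.Properties as Listₚ
open import Data.List.Membership.Propositional using (_∈_; lose)
open import Data.List.Membership.Propositional.Properties using (∈-map⁺; ∈-map⁻)
open import Data.List.Relation.Unary.All as All using (All; all?)
open import Data.List.Relation.Unary.All.Properties using (All¬⇒¬Any; all⁺; all⁻)
open import Data.List.Relation.Unary.AllPairs as AllPairs using (AllPairs; allPairs?)
import Data.List.Relation.Unary.AllPairs.Properties as AllPairsₚ
open import Data.List.Relation.Unary.Any as Any using (Any)
open import Data.List.Relation.Unary.Any.Properties using (any⁺; any⁻)
open import Data.List.Relation.Unary.Unique.Propositional using (Unique; []; _∷_)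
open import Data.Nat as ℕ using (ℕ; NonZero; _≤_)
open import Data.Nat.DivMod using (m<n⇒m%n≡m)
open import Data.Nat.ListAction using () renaming (sum to sumℕ)
import Data.Nat.Properties as ℕₚ
open import Data.Product using (_×_; _,_; ∃; uncurry)
open import Data.Rational as ℚ using (ℚ; 0ℚ; _/_) renaming (_≤_ to _≤ℚ_)
import Data.Rational.Properties as ℚₚ
open import Data.Sum using (_⊎_)
open import Data.Unit using (⊤; tt)
open import Data.Vec as Vec using (Vec; []; _∷_)
open import Data.Vec.Properties using (tabulate-cong; lookup∘tabulate; []=⇒lookup)
open import Function using (_∘_; id)
open import Function.Bundles using (_⇔_; mk⇔; Equivalence)
open import Relation.Binary.Definitions using (DecidableEquality)
open import Relation.Binary.PropositionalEquality
  using (_≡_; _≢_; refl; sym; trans; cong; cong₂; subst; module ≡-Reasoning)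
open import Relation.Nullary using (¬_; Dec; yes; no; ¬?; contradiction)
open import Relation.Nullary.Decidable
  using (⌊_⌋; T?; decidable-stable; _×-dec_; _⊎-dec_; _→-dec_; map′; toWitness; fromWitness)

-- N[_] and I in Defs test membership in nbrList exactly by memberᵇ _≟_.
memberᵇ : ∀ {A : Set} → DecidableEquality A → A → List A → Bool
memberᵇ _≟_ v = any (λ w → ⌊ v ≟ w ⌋)

module _ {A : Set} (_≟_ : DecidableEquality A) where

  T-memberᵇ⇔∈ : ∀ {v : A} {ws} → T (memberᵇ _≟_ v ws) ⇔ v ∈ ws
  T-memberᵇ⇔∈ {ws = ws} = mk⇔ (Any.map toWitness ∘ any⁻ _ ws) (any⁺ _ ∘ Any.map fromWitness)

  memberᵇ∧≡true⇔ : ∀ {v : A} {ws b} → (memberᵇ _≟_ v ws ∧ b) ≡ true ⇔ (v ∈ ws × b ≡ true)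
  memberᵇ∧≡true⇔ = mk⇔
    (λ e → let (m , t) = Equivalence.to T-∧ (Equivalence.from T-≡ e)
           in Equivalence.to T-memberᵇ⇔∈ m , Equivalence.to T-≡ t)
    (λ (v∈ws , t) → Equivalence.to T-≡
      (Equivalence.from T-∧ (Equivalence.from T-memberᵇ⇔∈ v∈ws , Equivalence.from T-≡ t)))

  memberᵇ-head-unique : ∀ {w : A} {ws} → Unique (w ∷ ws) → memberᵇ _≟_ w ws ≡ false
  memberᵇ-head-unique (w∉ws ∷ _) =
    ¬-not (All¬⇒¬Any w∉ws ∘ Equivalence.to T-memberᵇ⇔∈ ∘ Equivalence.from T-≡)

module _ {n : ℕ} .{{_ : NonZero n}} where

  open import Data.Integer using (_+_; _-_; _*_; -_)

  small-multiple≡0 : ∀ i k → ∣ i ∣ ℕ.< n → i ≡ k * + n → i ≡ 0ℤ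
  small-multiple≡0 _ k lt refl = begin
    k * + n   ≡⟨ cong (_* + n) (ℤₚ.∣i∣≡0⇒i≡0 {k} (factor≡0 ∣ k ∣ (subst (ℕ._< n) (ℤₚ.abs-* k (+ n)) lt))) ⟩
    0ℤ * + n  ≡⟨ ℤₚ.*-zeroˡ (+ n) ⟩
    0ℤ        ∎
    where
    open ≡-Reasoning
    factor≡0 : ∀ m → m ℕ.* n ℕ.< n → m ≡ 0
    factor≡0 ℕ.zero    _  = refl
    factor≡0 (ℕ.suc m) lt = contradiction lt (ℕₚ.≤⇒≯ (ℕₚ.m≤m+n n (m ℕ.* n)))

  %ℕ-≡⇒multiple : ∀ i j → i %ℕ n ≡ j %ℕ n → i - j ≡ (i /ℕ n - j /ℕ n) * + n
  %ℕ-≡⇒multiple i j eq = begin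
    i - j
      ≡⟨ cong₂ _-_ (a≡a%ℕn+[a/ℕn]*n i n) (a≡a%ℕn+[a/ℕn]*n j n) ⟩
    (+ (i %ℕ n) + i /ℕ n * + n) - (+ (j %ℕ n) + j /ℕ n * + n)
      ≡⟨ cong (λ r → (+ r + i /ℕ n * + n) - (+ (j %ℕ n) + j /ℕ n * + n)) eq ⟩
    (+ (j %ℕ n) + i /ℕ n * + n) - (+ (j %ℕ n) + j /ℕ n * + n)
      ≡⟨ cancel (+ (j %ℕ n)) (i /ℕ n) (j /ℕ n) (+ n) ⟩
    (i /ℕ n - j /ℕ n) * + n ∎
    where
    open ≡-Reasoning
    cancel : ∀ r p q m → (r + p * m) - (r + q * m) ≡ (p - q) * m
    cancel = solve-∀

  multiple⇒%ℕ-≡ : ∀ i j k → i - j ≡ k * + n → i %ℕ n ≡ j %ℕ n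
  multiple⇒%ℕ-≡ i j k eq = ℤₚ.+-injective (ℤₚ.i-j≡0⇒i≡j _ _
    (small-multiple≡0 (+ ri - + rj) (k - (qi - qj)) remainders-close difference))
    where
    open ≡-Reasoning
    ri = i %ℕ n
    rj = j %ℕ n
    qi = i /ℕ n
    qj = j /ℕ n
    remainders-close : ∣ + ri - + rj ∣ ℕ.< n
    remainders-close = subst (ℕ._< n) (cong ∣_∣ (sym (ℤₚ.m-n≡m⊖n ri rj)))
      (ℕₚ.≤-<-trans (ℤₚ.∣m⊝n∣≤m⊔n ri rj) (ℕₚ.⊔-lub (n%ℕd<d i n) (n%ℕd<d j n)))
    regroup : ∀ a b p q m → a - b ≡ ((a + p * m) - (b + q * m)) - (p - q) * m
    regroup = solve-∀
    factor : ∀ k p q m → k * m - (p - q) * m ≡ (k - (p - q)) * m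
    factor = solve-∀
    difference : + ri - + rj ≡ (k - (qi - qj)) * + n
    difference = begin
      + ri - + rj
        ≡⟨ regroup (+ ri) (+ rj) qi qj (+ n) ⟩
      ((+ ri + qi * + n) - (+ rj + qj * + n)) - (qi - qj) * + n
        ≡⟨ cong₂ (λ a b → (a - b) - (qi - qj) * + n) (a≡a%ℕn+[a/ℕn]*n i n) (a≡a%ℕn+[a/ℕn]*n j n) ⟨
      (i - j) - (qi - qj) * + n
        ≡⟨ cong (_- (qi - qj) * + n) eq ⟩
      k * + n - (qi - qj) * + n
        ≡⟨ factor k qi qj (+ n) ⟩
      (k - (qi - qj)) * + n ∎

  toℕ-⊕ : ∀ (u : Fin n) i → toℕ (u ⊕ i) ≡ (+ toℕ u + i) %ℕ n
  toℕ-⊕ u i = trans (toℕ-fromℕ< _) (m<n⇒m%n≡m (n%ℕd<d (+ toℕ u + i) n))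

  ⊕-identityʳ : ∀ (u : Fin n) → u ⊕ 0ℤ ≡ u
  ⊕-identityʳ u = toℕ-injective (begin
    toℕ (u ⊕ 0ℤ)          ≡⟨ toℕ-⊕ u 0ℤ ⟩
    (+ toℕ u + 0ℤ) %ℕ n   ≡⟨ cong (_%ℕ n) (ℤₚ.+-identityʳ (+ toℕ u)) ⟩
    toℕ u ℕ.% n           ≡⟨ m<n⇒m%n≡m (toℕ<n u) ⟩
    toℕ u                 ∎)
    where open ≡-Reasoning

  ⊕-assoc : ∀ (u : Fin n) i j → (u ⊕ i) ⊕ j ≡ u ⊕ (i + j)
  ⊕-assoc u i j = toℕ-injective (begin
    toℕ ((u ⊕ i) ⊕ j)              ≡⟨ toℕ-⊕ (u ⊕ i) j ⟩
    (+ toℕ (u ⊕ i) + j) %ℕ n       ≡⟨ multiple⇒%ℕ-≡ (+ toℕ (u ⊕ i) + j) (+ toℕ u + (i + j)) (- q) shift ⟩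
    (+ toℕ u + (i + j)) %ℕ n       ≡⟨ toℕ-⊕ u (i + j) ⟨
    toℕ (u ⊕ (i + j))              ∎)
    where
    open ≡-Reasoning
    a = + toℕ u + i
    q = a /ℕ n
    rearrange : ∀ r q m t i j → (r + j) - (t + (i + j)) ≡ - q * m + ((r + q * m) - (t + i))
    rearrange = solve-∀
    shift : (+ toℕ (u ⊕ i) + j) - (+ toℕ u + (i + j)) ≡ - q * + n
    shift = begin
      (+ toℕ (u ⊕ i) + j) - (+ toℕ u + (i + j))
        ≡⟨ cong (λ r → (+ r + j) - (+ toℕ u + (i + j))) (toℕ-⊕ u i) ⟩
      (+ (a %ℕ n) + j) - (+ toℕ u + (i + j))
        ≡⟨ rearrange (+ (a %ℕ n)) q (+ n) (+ toℕ u) i j ⟩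
      - q * + n + ((+ (a %ℕ n) + q * + n) - a)
        ≡⟨ cong (λ b → - q * + n + (b - a)) (a≡a%ℕn+[a/ℕn]*n a n) ⟨
      - q * + n + (a - a)
        ≡⟨ cong (λ b → - q * + n + b) (ℤₚ.+-inverseʳ a) ⟩
      - q * + n + 0ℤ
        ≡⟨ ℤₚ.+-identityʳ _ ⟩
      - q * + n ∎

  ⊕-injective : ∀ (u : Fin n) i j → ∣ i - j ∣ ℕ.< n → u ⊕ i ≡ u ⊕ j → i ≡ j
  ⊕-injective u i j close eq = ℤₚ.i-j≡0⇒i≡j i j (small-multiple≡0 (i - j) (qi - qj) close (begin
    i - j                           ≡⟨ cancel (+ toℕ u) i j ⟩
    (+ toℕ u + i) - (+ toℕ u + j)   ≡⟨ %ℕ-≡⇒multiple (+ toℕ u + i) (+ toℕ u + j) same-remainder ⟩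
    (qi - qj) * + n                 ∎))
    where
    open ≡-Reasoning
    qi = (+ toℕ u + i) /ℕ n
    qj = (+ toℕ u + j) /ℕ n
    same-remainder : (+ toℕ u + i) %ℕ n ≡ (+ toℕ u + j) %ℕ n
    same-remainder = trans (sym (toℕ-⊕ u i)) (trans (cong toℕ eq) (toℕ-⊕ u j))
    cancel : ∀ t i j → i - j ≡ (t + i) - (t + j)
    cancel = solve-∀

module _ {c ℓ} (M : CommutativeMonoid c ℓ) where

  open CommutativeMonoid M using (Carrier; _≈_; _∙_; ε; setoid; identityˡ; identityʳ; ∙-cong)
    renaming (refl to ≈-refl; sym to ≈-sym; trans to ≈-trans)
  open import Algebra.Properties.CommutativeMonoid.Sum M using (sum; ∑-distrib-+; sum-replicate-zero; sum-cong-≋)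
  open import Relation.Binary.Reasoning.Setoid setoid

  foldr-tabulate : ∀ {n} (f : Fin n → Carrier) → foldr _∙_ ε (List.tabulate f) ≡ sum f
  foldr-tabulate {ℕ.zero}  f = refl
  foldr-tabulate {ℕ.suc n} f = cong (f Fin.zero ∙_) (foldr-tabulate (f ∘ Fin.suc))

  sum-zero : ∀ {n} (g : Fin n → Carrier) → (∀ i → g i ≈ ε) → sum g ≈ ε
  sum-zero {n} g g≈0 = ≈-trans (sum-cong-≋ g≈0) (sum-replicate-zero n)

  sum-single : ∀ {n} (g : Fin n → Carrier) w → (∀ i → i ≢ w → g i ≈ ε) → sum g ≈ g w
  sum-single g Fin.zero off = begin
    g Fin.zero ∙ sum (g ∘ Fin.suc) ≈⟨ ∙-cong ≈-refl (sum-zero (g ∘ Fin.suc) (λ i → off (Fin.suc i) λ ())) ⟩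
    g Fin.zero ∙ ε                ≈⟨ identityʳ _ ⟩
    g Fin.zero                     ∎
  sum-single g (Fin.suc w) off = begin
    g Fin.zero ∙ sum (g ∘ Fin.suc) ≈⟨ ∙-cong (off Fin.zero λ ()) ≈-refl ⟩
    ε ∙ sum (g ∘ Fin.suc)         ≈⟨ identityˡ _ ⟩
    sum (g ∘ Fin.suc)              ≈⟨ sum-single (g ∘ Fin.suc) w (λ i → off (Fin.suc i) ∘ (_∘ suc-injective)) ⟩
    g (Fin.suc w)                  ∎

  sum-δ : ∀ {n} (f : Fin n → Carrier) w → sum (λ i → if ⌊ i ≟ w ⌋ then f i else ε) ≈ f w
  sum-δ f w = ≈-trans (sum-single _ w off) on-w
    where
    off : ∀ i → i ≢ w → (if ⌊ i ≟ w ⌋ then f i else ε) ≈ ε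
    off i i≢w with i ≟ w
    ... | yes i≡w = contradiction i≡w i≢w
    ... | no _    = ≈-refl
    on-w : (if ⌊ w ≟ w ⌋ then f w else ε) ≈ f w
    on-w with w ≟ w
    ... | yes _   = ≈-refl
    ... | no w≢w  = contradiction refl w≢w

  if-∨-disjoint : ∀ a b (y : Carrier) → (a ≡ true → b ≡ false) →
    (if a ∨ b then y else ε) ≈ (if a then y else ε) ∙ (if b then y else ε)
  if-∨-disjoint true  b y a⇒¬b rewrite a⇒¬b refl = ≈-sym (identityʳ y)
  if-∨-disjoint false b y _ = ≈-sym (identityˡ _)

  sum-indicator : ∀ {n} (f : Fin n → Carrier) {ws} → Unique ws →
    sum (λ i → if memberᵇ _≟_ i ws then f i else ε) ≈ foldr _∙_ ε (map f ws)
  sum-indicator {n} f {[]} [] = sum-replicate-zero n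
  sum-indicator f {w ∷ ws} uniq@(_ ∷ ws-unique) = begin
    sum (λ i → if memberᵇ _≟_ i (w ∷ ws) then f i else ε)
      ≈⟨ sum-cong-≋ (λ i → if-∨-disjoint ⌊ i ≟ w ⌋ (memberᵇ _≟_ i ws) (f i) (disjoint i)) ⟩
    sum (λ i → δ i ∙ rest i)
      ≈⟨ ∑-distrib-+ δ rest ⟩
    sum δ ∙ sum rest
      ≈⟨ ∙-cong (sum-δ f w) (sum-indicator f ws-unique) ⟩
    f w ∙ foldr _∙_ ε (map f ws) ∎
    where
    δ rest : Fin _ → Carrier
    δ i = if ⌊ i ≟ w ⌋ then f i else ε
    rest i = if memberᵇ _≟_ i ws then f i else ε
    disjoint : ∀ i → ⌊ i ≟ w ⌋ ≡ true → memberᵇ _≟_ i ws ≡ false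
    disjoint i i≟w with i ≟ w
    ... | yes refl = memberᵇ-head-unique _≟_ uniq

  foldr-tabulate-indicator : ∀ {n} (f : Fin n → Carrier) {ws} → Unique ws →
    foldr _∙_ ε (List.tabulate (λ i → if memberᵇ _≟_ i ws then f i else ε)) ≈ foldr _∙_ ε (map f ws)
  foldr-tabulate-indicator f {ws} uniq = begin
    foldr _∙_ ε (List.tabulate indicator) ≡⟨ foldr-tabulate indicator ⟩
    sum indicator                         ≈⟨ sum-indicator f uniq ⟩
    foldr _∙_ ε (map f ws)                ∎
    where
    indicator : Fin _ → Carrier
    indicator i = if memberᵇ _≟_ i ws then f i else ε

𝟙 : Bool → ℕ
𝟙 b = if b then 1 else 0

count-tabulate : ∀ {n} (g : Fin n → Bool) → Subset.∣ Vec.tabulate g ∣ ≡ sumℕ (List.tabulate (𝟙 ∘ g))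
count-tabulate {ℕ.zero}  g = refl
count-tabulate {ℕ.suc n} g with g Fin.zero
... | true  = cong ℕ.suc (count-tabulate (g ∘ Fin.suc))
... | false = count-tabulate (g ∘ Fin.suc)

offsets : ℤ → List ℤ
offsets i = i ∷ i ℤ.+ + 1 ∷ i ℤ.- + 1 ∷ i ℤ.+ + 3 ∷ i ℤ.- + 3 ∷ []

codewords : (ℤ → Bool) → ℤ → ℕ
codewords B i = sumℕ (map (𝟙 ∘ B) (offsets i))

localShare : (ℤ → Bool) → ℚ
localShare B = foldr ℚ._+_ 0ℚ (map (recip ∘ codewords B) (offsets 0ℤ))

dominatedᵇ : (ℤ → Bool) → ℤ → Bool
dominatedᵇ B i = any B (offsets i)

coversᵇ : (ℤ → Bool) → ℤ → ℤ → Bool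
coversᵇ B i j = all (λ a → not (B a) ∨ memberᵇ ℤ._≟_ a (offsets j)) (offsets i)

separatedᵇ : (ℤ → Bool) → ℤ → ℤ → Bool
separatedᵇ B i j = B i ∨ B j ∨ not (coversᵇ B i j ∧ coversᵇ B j i)

-- The instances of the locating-dominating conditions, at offsets from c, that the
-- enumeration below needs.
dominationChecks : List ℤ
dominationChecks = -[1+ 1 ] ∷ + 2 ∷ []

separationChecks : List (ℤ × ℤ)
separationChecks = (-[1+ 2 ] , -[1+ 0 ]) ∷ (+ 1 , + 3) ∷ (-[1+ 0 ] , + 1) ∷ (-[1+ 2 ] , + 1) ∷ (-[1+ 0 ] , + 3)
  ∷ (-[1+ 2 ] , + 3) ∷ (-[1+ 3 ] , -[1+ 1 ]) ∷ (+ 2 , + 4) ∷ (-[1+ 1 ] , + 2) ∷ []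

locallyLDᵇ : (ℤ → Bool) → Bool
locallyLDᵇ B = all (dominatedᵇ B) dominationChecks ∧ all (uncurry (separatedᵇ B)) separationChecks

dominatedᵇ-complete : ∀ B {i a} → a ∈ offsets i → B a ≡ true → T (dominatedᵇ B i)
dominatedᵇ-complete B a∈ Ba = any⁺ B (lose a∈ (Equivalence.from T-≡ Ba))

coversᵇ-sound : ∀ B {i j a} → T (coversᵇ B i j) → a ∈ offsets i → B a ≡ true → a ∈ offsets j
coversᵇ-sound B {i} {j} {a} cov a∈ Ba = Equivalence.to (T-memberᵇ⇔∈ ℤ._≟_)
  (subst (λ b → T (not b ∨ memberᵇ ℤ._≟_ a (offsets j))) Ba
    (All.lookup (all⁺ covered (offsets i) cov) a∈))
  where
  covered : ℤ → Bool
  covered a = not (B a) ∨ memberᵇ ℤ._≟_ a (offsets j)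

separatedᵇ-false : ∀ B {i j} → ¬ T (separatedᵇ B i j) →
  B i ≡ false × B j ≡ false × T (coversᵇ B i j) × T (coversᵇ B j i)
separatedᵇ-false B {i} {j} ¬sep =
  let (Bi , Bj , covers) = ¬T-∨-∨-not (B i) (B j) (coversᵇ B i j ∧ coversᵇ B j i) ¬sep
  in Bi , Bj , Equivalence.to T-∧ covers
  where
  ¬T-∨-∨-not : ∀ x y z → ¬ T (x ∨ y ∨ not z) → x ≡ false × y ≡ false × T z
  ¬T-∨-∨-not true  _     _     ¬t = contradiction _ ¬t
  ¬T-∨-∨-not false true  _     ¬t = contradiction _ ¬t
  ¬T-∨-∨-not false false false ¬t = contradiction _ ¬t
  ¬T-∨-∨-not false false true  _  = refl , refl , _

Matches : (ℤ → Bool) → (ℤ → ℤ) → ℤ → List Sym → Set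
Matches B σ i []       = ⊤
Matches B σ i (s ∷ ws) = satisfies (B (σ i)) s × Matches B σ (ℤ.suc i) ws

-- For each concrete pattern P, BelongsTo C c P is definitionally Belongs (localView C c) P.
Belongs : (ℤ → Bool) → Pattern → Set
Belongs B (pat s w) = Matches B id s w ⊎ Matches B ℤ.-_ s w

Classification : ℚ → (P₁ P₃ P₄ P₆ : Set) → Set
Classification s P₁ P₃ P₄ P₆ =
  (s ≤ℚ + 17 / 6 ⊎ s ≡ + 3 / 1 ⊎ s ≡ + 37 / 12 ⊎ s ≡ + 10 / 3)
  × (s ≡ + 3 / 1 ⇔ (P₁ ⊎ P₃))
  × (s ≡ + 37 / 12 ⇔ P₄)
  × (s ≡ + 10 / 3 ⇔ P₆)

LocalClassification : (ℤ → Bool) → Set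
LocalClassification B = Classification (localShare B) (Belongs B S1) (Belongs B S3) (Belongs B S4) (Belongs B S6)

_⇔-dec_ : ∀ {A B : Set} → Dec A → Dec B → Dec (A ⇔ B)
a? ⇔-dec b? = map′ (λ (f , g) → mk⇔ f g) (λ e → Equivalence.to e , Equivalence.from e)
  ((a? →-dec b?) ×-dec (b? →-dec a?))

satisfies? : ∀ b s → Dec (satisfies b s)
satisfies? b x = b Bool.≟ true
satisfies? b o = b Bool.≟ false
satisfies? b ✱ = yes tt

matches? : ∀ B σ i w → Dec (Matches B σ i w)
matches? B σ i []       = yes tt
matches? B σ i (s ∷ ws) = satisfies? (B (σ i)) s ×-dec matches? B σ (ℤ.suc i) ws

belongs? : ∀ B P → Dec (Belongs B P)
belongs? B (pat s w) = matches? B id s w ⊎-dec matches? B ℤ.-_ s w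

classification? : ∀ s {P₁ P₃ P₄ P₆} → Dec P₁ → Dec P₃ → Dec P₄ → Dec P₆ → Dec (Classification s P₁ P₃ P₄ P₆)
classification? s P₁? P₃? P₄? P₆? =
  ((s ℚₚ.≤? + 17 / 6) ⊎-dec (s ℚₚ.≟ + 3 / 1) ⊎-dec (s ℚₚ.≟ + 37 / 12) ⊎-dec (s ℚₚ.≟ + 10 / 3))
  ×-dec ((s ℚₚ.≟ + 3 / 1) ⇔-dec (P₁? ⊎-dec P₃?))
  ×-dec ((s ℚₚ.≟ + 37 / 12) ⇔-dec P₄?)
  ×-dec ((s ℚₚ.≟ + 10 / 3) ⇔-dec P₆?)

localClassification? : ∀ B → Dec (LocalClassification B)
localClassification? B =
  classification? (localShare B) (belongs? B S1) (belongs? B S3) (belongs? B S4) (belongs? B S6)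

allᵇ : ∀ n → (Vec Bool n → Bool) → Bool
allᵇ ℕ.zero    f = f []
allᵇ (ℕ.suc n) f = allᵇ n (f ∘ (true ∷_)) ∧ allᵇ n (f ∘ (false ∷_))

allᵇ-sound : ∀ n (f : Vec Bool n → Bool) → T (allᵇ n f) → ∀ v → T (f v)
allᵇ-sound ℕ.zero    f holds [] = holds
allᵇ-sound (ℕ.suc n) f holds (b ∷ v) with Equivalence.to (T-∧ {allᵇ n (f ∘ (true ∷_))}) holds
allᵇ-sound (ℕ.suc n) f holds (true ∷ v)  | on-true , _ = allᵇ-sound n (f ∘ (true ∷_)) on-true v
allᵇ-sound (ℕ.suc n) f holds (false ∷ v) | _ , on-false = allᵇ-sound n (f ∘ (false ∷_)) on-false v

window : Vec Bool 15 → ℤ → Bool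
window (b₀ ∷ b₁ ∷ b₂ ∷ b₃ ∷ b₄ ∷ b₅ ∷ b₆ ∷ b₇ ∷ b₈ ∷ b₉ ∷ b₁₀ ∷ b₁₁ ∷ b₁₂ ∷ b₁₃ ∷ b₁₄ ∷ []) i with i
... | -[1+ 6 ] = b₀
... | -[1+ 5 ] = b₁
... | -[1+ 4 ] = b₂
... | -[1+ 3 ] = b₃
... | -[1+ 2 ] = b₄
... | -[1+ 1 ] = b₅
... | -[1+ 0 ] = b₆
... | + 0      = b₇
... | + 1      = b₈
... | + 2      = b₉
... | + 3      = b₁₀
... | + 4      = b₁₁
... | + 5      = b₁₂
... | + 6      = b₁₃
... | + 7      = b₁₄
... | _        = false

sample : (ℤ → Bool) → Vec Bool 15
sample B = B -[1+ 6 ] ∷ B -[1+ 5 ] ∷ B -[1+ 4 ] ∷ B -[1+ 3 ] ∷ B -[1+ 2 ] ∷ B -[1+ 1 ] ∷ B -[1+ 0 ]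
  ∷ B (+ 0) ∷ B (+ 1) ∷ B (+ 2) ∷ B (+ 3) ∷ B (+ 4) ∷ B (+ 5) ∷ B (+ 6) ∷ B (+ 7) ∷ []

LocalClaim : (ℤ → Bool) → Set
LocalClaim B = B 0ℤ ≡ true → T (locallyLDᵇ B) → LocalClassification B

localClaim? : ∀ B → Dec (LocalClaim B)
localClaim? B = (B 0ℤ Bool.≟ true) →-dec (T? (locallyLDᵇ B) →-dec localClassification? B)

-- LocalClaim B applies B only to literals in [-7, 7], so LocalClaim (window (sample B))
-- is definitionally LocalClaim B.
local-classification : ∀ B → LocalClaim B
local-classification B = toWitness (allᵇ-sound 15 (⌊_⌋ ∘ localClaim? ∘ window) _ (sample B))

offsets-spread : AllPairs (λ a b → a ≢ b × ∣ a ℤ.- b ∣ ℕ.≤ 6) (offsets 0ℤ)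
offsets-spread = toWitness {a? = allPairs? (λ a b → ¬? (a ℤ.≟ b) ×-dec (∣ a ℤ.- b ∣ ℕₚ.≤? 6)) (offsets 0ℤ)} _

separationChecks-spread : All (λ (i , j) → i ≢ j × ∣ i ℤ.- j ∣ ℕ.≤ 6) separationChecks
separationChecks-spread =
  toWitness {a? = all? (λ (i , j) → ¬? (i ℤ.≟ j) ×-dec (∣ i ℤ.- j ∣ ℕₚ.≤? 6)) separationChecks} _

module _ {n : ℕ} .{{_ : NonZero n}} where

  localView : Code n → Fin n → ℤ → Bool
  localView C c i = C (c ⊕ i)

  nbrList-⊕ : ∀ (c : Fin n) i → nbrList (c ⊕ i) ≡ map (c ⊕_) (offsets i)
  nbrList-⊕ c i = cong ((c ⊕ i) ∷_) (cong₂ _∷_ (⊕-assoc c i (+ 1)) (cong₂ _∷_ (⊕-assoc c i (ℤ.- + 1))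
    (cong₂ _∷_ (⊕-assoc c i (+ 3)) (cong₂ _∷_ (⊕-assoc c i (ℤ.- + 3)) refl))))

  nbrList≡map-offsets : ∀ (c : Fin n) → nbrList c ≡ map (c ⊕_) (offsets 0ℤ)
  nbrList≡map-offsets c = trans (cong nbrList (sym (⊕-identityʳ c))) (nbrList-⊕ c 0ℤ)

  nbrList-unique : 7 ≤ n → ∀ u → Unique (nbrList u)
  nbrList-unique 7≤n u = subst Unique (sym (nbrList≡map-offsets u))
    (AllPairsₚ.map⁺ (AllPairs.map (λ {a} {b} → distinct a b) offsets-spread))
    where
    distinct : ∀ a b → a ≢ b × ∣ a ℤ.- b ∣ ℕ.≤ 6 → u ⊕ a ≢ u ⊕ b
    distinct a b (a≢b , close) = a≢b ∘ ⊕-injective u a b (ℕₚ.<-≤-trans (ℕ.s≤s close) 7≤n)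

  ∣I∣≡codewords : 7 ≤ n → ∀ (C : Code n) c i → Subset.∣ I C (c ⊕ i) ∣ ≡ codewords (localView C c) i
  ∣I∣≡codewords 7≤n C c i = begin
    Subset.∣ I C (c ⊕ i) ∣
      ≡⟨ count-tabulate (λ v → memberᵇ _≟_ v L ∧ C v) ⟩
    sumℕ (List.tabulate (λ v → 𝟙 (memberᵇ _≟_ v L ∧ C v)))
      ≡⟨ cong sumℕ (Listₚ.tabulate-cong split) ⟩
    sumℕ (List.tabulate (λ v → if memberᵇ _≟_ v L then 𝟙 (C v) else 0))
      ≡⟨ foldr-tabulate-indicator ℕₚ.+-0-commutativeMonoid (𝟙 ∘ C) (nbrList-unique 7≤n (c ⊕ i)) ⟩
    sumℕ (map (𝟙 ∘ C) L)
      ≡⟨ cong (sumℕ ∘ map (𝟙 ∘ C)) (nbrList-⊕ c i) ⟩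
    sumℕ (map (𝟙 ∘ C) (map (c ⊕_) (offsets i)))
      ≡⟨ cong sumℕ (map-∘ {g = 𝟙 ∘ C} {f = c ⊕_} (offsets i)) ⟨
    codewords (localView C c) i ∎
    where
    open ≡-Reasoning
    L = nbrList (c ⊕ i)
    split : ∀ v → 𝟙 (memberᵇ _≟_ v L ∧ C v) ≡ (if memberᵇ _≟_ v L then 𝟙 (C v) else 0)
    split v with memberᵇ _≟_ v L
    ... | true  = refl
    ... | false = refl

  share≡localShare : 7 ≤ n → ∀ (C : Code n) c → share C c ≡ localShare (localView C c)
  share≡localShare 7≤n C c = begin
    share C c
      ≡⟨ cong (foldr ℚ._+_ 0ℚ) (map-tabulate id term) ⟩
    foldr ℚ._+_ 0ℚ (List.tabulate term)
      ≡⟨ cong (foldr ℚ._+_ 0ℚ) (Listₚ.tabulate-cong (λ u → cong (if_then share-of u else 0ℚ) (in-N u))) ⟩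
    foldr ℚ._+_ 0ℚ (List.tabulate (λ u → if memberᵇ _≟_ u (nbrList c) then share-of u else 0ℚ))
      ≡⟨ foldr-tabulate-indicator ℚₚ.+-0-commutativeMonoid share-of (nbrList-unique 7≤n c) ⟩
    foldr ℚ._+_ 0ℚ (map share-of (nbrList c))
      ≡⟨ cong (foldr ℚ._+_ 0ℚ ∘ map share-of) (nbrList≡map-offsets c) ⟩
    foldr ℚ._+_ 0ℚ (map share-of (map (c ⊕_) (offsets 0ℤ)))
      ≡⟨ cong (foldr ℚ._+_ 0ℚ) (map-∘ {g = share-of} {f = c ⊕_} (offsets 0ℤ)) ⟨
    foldr ℚ._+_ 0ℚ (map (share-of ∘ (c ⊕_)) (offsets 0ℤ))
      ≡⟨ cong (foldr ℚ._+_ 0ℚ) (map-cong (cong recip ∘ ∣I∣≡codewords 7≤n C c) (offsets 0ℤ)) ⟩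
    localShare (localView C c) ∎
    where
    open ≡-Reasoning
    share-of term : Fin n → ℚ
    share-of u = recip Subset.∣ I C u ∣
    term u = if Vec.lookup N[ c ] u then share-of u else 0ℚ
    in-N : ∀ u → Vec.lookup N[ c ] u ≡ memberᵇ _≟_ u (nbrList c)
    in-N = lookup∘tabulate (λ v → memberᵇ _≟_ v (nbrList c))

  ∈-nbrList-⊕⁻ : ∀ (c : Fin n) {v} i → v ∈ nbrList (c ⊕ i) → ∃ λ a → a ∈ offsets i × v ≡ c ⊕ a
  ∈-nbrList-⊕⁻ c {v} i v∈N = ∈-map⁻ (c ⊕_) (subst (v ∈_) (nbrList-⊕ c i) v∈N)

  ∈-nbrList-⊕⁺ : ∀ (c : Fin n) {a} i → a ∈ offsets i → c ⊕ a ∈ nbrList (c ⊕ i)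
  ∈-nbrList-⊕⁺ c {a} i a∈ = subst (c ⊕ a ∈_) (sym (nbrList-⊕ c i)) (∈-map⁺ (c ⊕_) a∈)

  module _ (C : Code n) (c : Fin n) where

    private
      B = localView C c

      InI : Fin n → Fin n → Set
      InI u v = (memberᵇ _≟_ v (nbrList u) ∧ C v) ≡ true

    ∈-I⇒InI : ∀ {u v} → v Subset.∈ I C u → InI u v
    ∈-I⇒InI {u} {v} v∈I =
      trans (sym (lookup∘tabulate (λ w → memberᵇ _≟_ w (nbrList u) ∧ C w) v)) ([]=⇒lookup v∈I)

    InI-⊕⁻ : ∀ {v} i → InI (c ⊕ i) v → ∃ λ a → a ∈ offsets i × v ≡ c ⊕ a × B a ≡ true
    InI-⊕⁻ i v∈I =
      let (v∈N , Cv)    = Equivalence.to (memberᵇ∧≡true⇔ _≟_) v∈I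
          (a , a∈ , v≡) = ∈-nbrList-⊕⁻ c i v∈N
      in a , a∈ , v≡ , subst (λ w → C w ≡ true) v≡ Cv

    InI-⊕⁺ : ∀ {a} j → a ∈ offsets j → B a ≡ true → InI (c ⊕ j) (c ⊕ a)
    InI-⊕⁺ j a∈ Ba = Equivalence.from (memberᵇ∧≡true⇔ _≟_) (∈-nbrList-⊕⁺ c j a∈ , Ba)

    dominated : (∀ u → I C u ≢ Subset.⊥) → ∀ i → T (dominatedᵇ B i)
    dominated nonempty i = decidable-stable (T? (dominatedᵇ B i)) λ ¬dominated →
      nonempty (c ⊕ i) (Empty-unique λ (v , v∈I) →
        let (a , a∈ , _ , Ba) = InI-⊕⁻ i (∈-I⇒InI v∈I)
        in ¬dominated (dominatedᵇ-complete B a∈ Ba))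

    I-mono : ∀ i j {v} → T (coversᵇ B i j) → InI (c ⊕ i) v → InI (c ⊕ j) v
    I-mono i j cov v∈I =
      let (a , a∈ , v≡ , Ba) = InI-⊕⁻ i v∈I
      in subst (InI (c ⊕ j)) (sym v≡) (InI-⊕⁺ j (coversᵇ-sound B cov a∈ Ba) Ba)

    separated : (∀ u v → C u ≡ false → C v ≡ false → u ≢ v → I C u ≢ I C v) →
      ∀ i j → c ⊕ i ≢ c ⊕ j → T (separatedᵇ B i j)
    separated locating i j ci≢cj = decidable-stable (T? (separatedᵇ B i j)) λ ¬separated →
      let (Bi , Bj , i⊆j , j⊆i) = separatedᵇ-false B {i} {j} ¬separated
      in locating (c ⊕ i) (c ⊕ j) Bi Bj ci≢cj
           (tabulate-cong λ v → ⇔→≡ (mk⇔ (I-mono i j i⊆j) (I-mono j i j⊆i)))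

    locallyLD : 7 ≤ n → IsLocatingDominating C → T (locallyLDᵇ B)
    locallyLD 7≤n (_ , nonempty , locating) =
      Equivalence.from (T-∧ {all (dominatedᵇ B) dominationChecks})
        (all⁻ (dominatedᵇ B) dominations , all⁻ (uncurry (separatedᵇ B)) separations)
      where
      dominations : All (T ∘ dominatedᵇ B) dominationChecks
      dominations = All.tabulate (λ {i} _ → dominated nonempty i)
      separations : All (T ∘ uncurry (separatedᵇ B)) separationChecks
      separations = All.tabulate λ {(i , j)} ij∈ →
        let (i≢j , close) = All.lookup separationChecks-spread ij∈
        in separated locating i j (i≢j ∘ ⊕-injective c i j (ℕₚ.<-≤-trans (ℕ.s≤s close) 7≤n))

proposition7 : (n : ℕ) .{{_ : NonZero n}} → 14 ≤ n →
    (C : Code n) → IsLocatingDominating C →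
    (c : Fin n) → C c ≡ true →
      (share C c ≤ℚ (+ 17 / 6)
        ⊎ share C c ≡ + 3 / 1 ⊎ share C c ≡ + 37 / 12 ⊎ share C c ≡ + 10 / 3)
      × (share C c ≡ + 3 / 1 ⇔ (BelongsTo C c S1 ⊎ BelongsTo C c S3))
      × (share C c ≡ + 37 / 12 ⇔ BelongsTo C c S4)
      × (share C c ≡ + 10 / 3 ⇔ BelongsTo C c S6)
proposition7 n 14≤n C ld c c∈C =
  subst (λ s → Classification s (BelongsTo C c S1) (BelongsTo C c S3) (BelongsTo C c S4) (BelongsTo C c S6))
    (sym (share≡localShare 7≤n C c))
    (local-classification (localView C c) centre-in-code (locallyLD C c 7≤n ld))
  where
  7≤n : 7 ≤ n
  7≤n = ℕₚ.≤-trans (ℕₚ.m≤m+n 7 7) 14≤n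
  centre-in-code : localView C c 0ℤ ≡ true
  centre-in-code = trans (cong C (⊕-identityʳ c)) c∈C
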